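{- Every edge simplicial graph is semi-weakly CIS.
   Context: A clique $K$ of $G$ is simplicial if $K=N[v]$ for some vertex $v$ (closed neighborhood). A graph is edge simplicial if every edge is contained in a simplicial clique. A strong clique is a clique meeting every maximal stable set of $G$. A graph is semi-weakly CIS if it admits an edge covering family of strong cliques, i.e., a family of strong cliques such that every two adjacent vertices are contained together in some member of the family. -}

module Defs where

open import Data.Nat using (ℕ)
open import Data.Fin using (Fin)
open import Data.Fin.Subset using (Subset; _∈_; _⊆_)
open import Data.Product using (Σ; ∃; _×_)
open import Data.Sum using (_⊎_)
open import Data.List using (List)
open import Data.List.Relation.Unary.All using (All)
open import Data.List.Relation.Unary.Any using (Any)
open import Relation.Binary.PropositionalEquality using (_≡_; _≢_)
open import Relation.Nullary using (¬_; Dec)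
open import Function.Bundles using (_⇔_)

record Graph (n : ℕ) : Set₁ where
  field
    Adj     : Fin n → Fin n → Set
    adj?    : ∀ u v → Dec (Adj u v)
    sym     : ∀ {u v} → Adj u v → Adj v u
    irrefl  : ∀ {u} → ¬ Adj u u

module _ {n : ℕ} (G : Graph n) where
  open Graph G

  IsClique : Subset n → Set
  IsClique K = ∀ {u v} → u ∈ K → v ∈ K → u ≢ v → Adj u v

  IsStable : Subset n → Set
  IsStable S = ∀ {u v} → u ∈ S → v ∈ S → ¬ Adj u v

  IsMaximalStable : Subset n → Set
  IsMaximalStable S = IsStable S × (∀ T → IsStable T → S ⊆ T → T ⊆ S)

  InClosedNbhd : Fin n → Fin n → Set
  InClosedNbhd v u = u ≡ v ⊎ Adj v u

  IsSimplicialClique : Subset n → Set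
  IsSimplicialClique K =
    IsClique K × ∃ λ v → ∀ u → (u ∈ K) ⇔ InClosedNbhd v u

  EdgeSimplicial : Set
  EdgeSimplicial = ∀ {u v} → Adj u v →
    ∃ λ K → IsSimplicialClique K × u ∈ K × v ∈ K

  IsStrongClique : Subset n → Set
  IsStrongClique K =
    IsClique K × (∀ S → IsMaximalStable S → ∃ λ v → v ∈ K × v ∈ S)

  SemiWeaklyCIS : Set
  SemiWeaklyCIS = Σ (List (Subset n)) λ 𝓚 →
    All IsStrongClique 𝓚 ×
    (∀ {u v} → Adj u v → Any (λ K → u ∈ K × v ∈ K) 𝓚)

module Submission where

-- (1) Simplicial cliques are strong.  A maximal stable set S meets every
--     closed neighbourhood N[v]: if it contained neither v nor a neighbour
--     of v, then S ∪ {v} would be a strictly larger stable set.  A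
--     simplicial clique is some N[v], hence it meets every maximal stable
--     set.
--
-- (2) Finite collection of choices.  Over the finite vertex set Fin n, a
--     choice of one object per pair related by a decidable relation can be
--     gathered into a single finite list (run through all pairs of
--     vertices).
--
-- Edge simpliciality chooses, for each edge, a simplicial clique covering
-- it; by (1) each chosen clique is strong, and (2) collects them into an
-- edge covering family of strong cliques.

open import Data.Nat using (ℕ)
open import Data.Fin using (Fin)
open import Data.Fin.Subset using (Subset; _∈_; _∪_; ⁅_⁆)
open import Data.Fin.Subset.Properties using (_∈?_; x∈⁅x⁆; x∈⁅y⁆⇒x≡y; p⊆p∪q; q⊆p∪q; x∈p∪q⁻)
open import Data.Fin.Properties using (any?)
open import Data.Product using (Σ; ∃; _×_; _,_; proj₁; proj₂)
open import Data.Sum using (_⊎_; inj₁; inj₂)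
open import Data.List using (List; []; _∷_; allFin; cartesianProduct; concatMap)
open import Data.List.Relation.Unary.All using (All; []; _∷_; universal)
open import Data.List.Relation.Unary.Any using (Any; here)
open import Data.List.Membership.Propositional using (lose)
open import Data.List.Membership.Propositional.Properties using (∈-allFin; ∈-cartesianProduct⁺)
import Data.List.Relation.Unary.All.Properties as All
import Data.List.Relation.Unary.Any.Properties as Any
open import Relation.Binary.PropositionalEquality using (_≡_; refl)
open import Relation.Nullary using (¬_; Dec; yes; no)
open import Relation.Nullary.Decidable using (_×-dec_)
open import Data.Empty using (⊥-elim)
open import Function.Bundles using (Equivalence)
open import Defs

∈⁅v⁆∪S : ∀ {n} {S : Subset n} {v x} → x ∈ ⁅ v ⁆ ∪ S → x ≡ v ⊎ x ∈ S
∈⁅v⁆∪S {S = S} {v} x∈T with x∈p∪q⁻ ⁅ v ⁆ S x∈T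
... | inj₁ x∈⁅v⁆ = inj₁ (x∈⁅y⁆⇒x≡y v x∈⁅v⁆)
... | inj₂ x∈S   = inj₂ x∈S

module _ {n : ℕ} (G : Graph n) where
  open Graph G

  stable-∪-nonneighbour : ∀ {S v} → IsStable G S →
    (∀ {u} → u ∈ S → ¬ Adj v u) → IsStable G (⁅ v ⁆ ∪ S)
  stable-∪-nonneighbour {S} {v} stS isolated {x} {y} x∈T y∈T
    with ∈⁅v⁆∪S x∈T | ∈⁅v⁆∪S y∈T
  ... | inj₁ refl | inj₁ refl = irrefl
  ... | inj₁ refl | inj₂ y∈S  = isolated y∈S
  ... | inj₂ x∈S  | inj₁ refl = λ adj → isolated x∈S (sym adj)
  ... | inj₂ x∈S  | inj₂ y∈S  = stS x∈S y∈S

  maximalStable-meets-N[v] : ∀ {S} → IsMaximalStable G S →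
    ∀ v → ∃ λ u → u ∈ S × InClosedNbhd G v u
  maximalStable-meets-N[v] {S} (stS , maximal) v with v ∈? S
  ... | yes v∈S = v , v∈S , inj₁ refl
  ... | no  v∉S with any? (λ u → (u ∈? S) ×-dec adj? v u)
  ...   | yes (u , u∈S , adj) = u , u∈S , inj₂ adj
  ...   | no  noNeighbour = ⊥-elim (v∉S v∈S)
    where
    extended-stable : IsStable G (⁅ v ⁆ ∪ S)
    extended-stable =
      stable-∪-nonneighbour stS (λ {u} u∈S adj → noNeighbour (u , u∈S , adj))

    v∈S : v ∈ S
    v∈S = maximal (⁅ v ⁆ ∪ S) extended-stable (q⊆p∪q ⁅ v ⁆ S)
                  (p⊆p∪q S (x∈⁅x⁆ v))

  simplicial⇒strong : ∀ {K} → IsSimplicialClique G K → IsStrongClique G K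
  simplicial⇒strong {K} (isClique , v , K≡N[v]) = isClique , meets
    where
    meets : ∀ S → IsMaximalStable G S → ∃ λ u → u ∈ K × u ∈ S
    meets S maxS with maximalStable-meets-N[v] maxS v
    ... | u , u∈S , u∈N[v] = u , Equivalence.from (K≡N[v] u) u∈N[v] , u∈S

module _ {n : ℕ} {A : Set} {R : Fin n → Fin n → Set}
         (R? : ∀ u v → Dec (R u v)) {P : A → Set} {Q : Fin n → Fin n → A → Set}
         (choose : ∀ {u v} → R u v → Σ A λ x → P x × Q u v x) where

  chosenAt : Fin n × Fin n → List A
  chosenAt (u , v) with R? u v
  ... | yes r = proj₁ (choose r) ∷ []
  ... | no  _ = []

  chosenAt-P : ∀ uv → All P (chosenAt uv)
  chosenAt-P (u , v) with R? u v
  ... | yes r = proj₁ (proj₂ (choose r)) ∷ []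
  ... | no  _ = []

  chosenAt-Q : ∀ {u v} → R u v → Any (Q u v) (chosenAt (u , v))
  chosenAt-Q {u} {v} r with R? u v
  ... | yes r′ = here (proj₂ (proj₂ (choose r′)))
  ... | no ¬r  = ⊥-elim (¬r r)

  collectChoices : Σ (List A) λ xs →
    All P xs × (∀ {u v} → R u v → Any (Q u v) xs)
  collectChoices = concatMap chosenAt pairs , all-P , any-Q
    where
    pairs : List (Fin n × Fin n)
    pairs = cartesianProduct (allFin n) (allFin n)

    all-P : All P (concatMap chosenAt pairs)
    all-P = All.concat⁺ (All.map⁺ (universal chosenAt-P pairs))

    any-Q : ∀ {u v} → R u v → Any (Q u v) (concatMap chosenAt pairs)
    any-Q {u} {v} r = Any.concatMap⁺ chosenAt
      (lose (∈-cartesianProduct⁺ (∈-allFin u) (∈-allFin v)) (chosenAt-Q r))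

proposition14 : ∀ (n : ℕ) (G : Graph n) → EdgeSimplicial G → SemiWeaklyCIS G
proposition14 n G edgeSimplicial =
  collectChoices (Graph.adj? G) strongCliqueCovering
  where
  strongCliqueCovering : ∀ {u v} → Graph.Adj G u v →
    ∃ λ K → IsStrongClique G K × u ∈ K × v ∈ K
  strongCliqueCovering adj with edgeSimplicial adj
  ... | K , simplicial , covers = K , simplicial⇒strong G simplicial , covers
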